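{- Let $A$ be a good pseudo-hoop. Then ${\rm Den}(A)$ is a normal filter of $A$ and an involutive filter of $A$.
   Context: A pseudo-hoop is an algebra $(A,\odot,\rightarrow,\rightsquigarrow,1)$ of type $(2,2,2,0)$ such that for all $x,y,z\in A$: $x\odot 1=1\odot x=x$; $x\rightarrow x=x\rightsquigarrow x=1$; $(x\odot y)\rightarrow z=x\rightarrow(y\rightarrow z)$; $(x\odot y)\rightsquigarrow z=y\rightsquigarrow(x\rightsquigarrow z)$; $(x\rightarrow y)\odot x=(y\rightarrow x)\odot y=x\odot(x\rightsquigarrow y)=y\odot(y\rightsquigarrow x)$. The order is $x\le y$ iff $x\rightarrow y=1$. It is bounded if it has a least element $0$; then $x^-=x\rightarrow 0$, $x^\sim=x\rightsquigarrow 0$, $x^{ -\sim}=(x^-)^\sim$, $x^{\sim- }=(x^\sim)^-$. A bounded pseudo-hoop is good if $x^{ -\sim}=x^{\sim- }$ for all $x$. ${\rm Den}(A)=\{x\in A\mid x^{ -\sim}=x^{\sim- }=1\}$. A filter is a nonempty $F\subseteq A$ closed under $\odot$ and upward closed. A filter $F$ is normal if for all $x,y\in A$: $x\rightarrow y\in F$ iff $x\rightsquigarrow y\in F$. A filter $F$ is involutive if $x^{ -\sim}\rightarrow x\in F$ and $x^{\sim- }\rightsquigarrow x\in F$ for all $x\in A$. -}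

module Defs where

open import Level using (Level; suc; _⊔_)
open import Relation.Binary.PropositionalEquality using (_≡_)
open import Data.Product using (_×_; ∃)
open import Function.Bundles using (_⇔_)

record PseudoHoop (a : Level) : Set (suc a) where
  infixl 7 _⊙_
  infixr 5 _⇒_ _⇝_
  field
    Carrier : Set a
    _⊙_ : Carrier → Carrier → Carrier
    _⇒_ : Carrier → Carrier → Carrier
    _⇝_ : Carrier → Carrier → Carrier
    𝟙 : Carrier
    ⊙-identityʳ : ∀ x → x ⊙ 𝟙 ≡ x
    ⊙-identityˡ : ∀ x → 𝟙 ⊙ x ≡ x
    ⇒-refl : ∀ x → x ⇒ x ≡ 𝟙
    ⇝-refl : ∀ x → x ⇝ x ≡ 𝟙
    ⊙-⇒ : ∀ x y z → (x ⊙ y) ⇒ z ≡ x ⇒ (y ⇒ z)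
    ⊙-⇝ : ∀ x y z → (x ⊙ y) ⇝ z ≡ y ⇝ (x ⇝ z)
    div₁ : ∀ x y → (x ⇒ y) ⊙ x ≡ (y ⇒ x) ⊙ y
    div₂ : ∀ x y → (y ⇒ x) ⊙ y ≡ x ⊙ (x ⇝ y)
    div₃ : ∀ x y → x ⊙ (x ⇝ y) ≡ y ⊙ (y ⇝ x)

  _≤_ : Carrier → Carrier → Set a
  x ≤ y = x ⇒ y ≡ 𝟙

record BoundedPseudoHoop (a : Level) : Set (suc a) where
  field
    pseudoHoop : PseudoHoop a
  open PseudoHoop pseudoHoop public
  field
    𝟘 : Carrier
    𝟘-least : ∀ x → 𝟘 ≤ x

  _⁻ : Carrier → Carrier
  x ⁻ = x ⇒ 𝟘

  _∼ : Carrier → Carrier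
  x ∼ = x ⇝ 𝟘

  _⁻∼ : Carrier → Carrier
  x ⁻∼ = (x ⁻) ∼

  _∼⁻ : Carrier → Carrier
  x ∼⁻ = (x ∼) ⁻

module _ {a : Level} (A : BoundedPseudoHoop a) where
  open BoundedPseudoHoop A

  IsGood : Set a
  IsGood = ∀ x → x ⁻∼ ≡ x ∼⁻

  Den : Carrier → Set a
  Den x = (x ⁻∼ ≡ 𝟙) × (x ∼⁻ ≡ 𝟙)

  record IsFilter {ℓ : Level} (F : Carrier → Set ℓ) : Set (a ⊔ ℓ) where
    field
      nonempty : ∃ F
      ⊙-closed : ∀ {x y} → F x → F y → F (x ⊙ y)
      upward   : ∀ {x y} → F x → x ≤ y → F y

  record IsNormalFilter {ℓ : Level} (F : Carrier → Set ℓ) : Set (a ⊔ ℓ) where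
    field
      isFilter : IsFilter F
      normal   : ∀ x y → F (x ⇒ y) ⇔ F (x ⇝ y)

  record IsInvolutiveFilter {ℓ : Level} (F : Carrier → Set ℓ) : Set (a ⊔ ℓ) where
    field
      isFilter : IsFilter F
      inv₁ : ∀ x → F ((x ⁻∼) ⇒ x)
      inv₂ : ∀ x → F ((x ∼⁻) ⇝ x)

-- In a good pseudo-hoop x⁻∼ = x∼⁻, so x ∈ Den(A) iff x⁻ = 0 iff x∼ = 0, which makes
-- Den(A) an upward closed set closed under ⊙.  The key fact is x⁻∼ → x ∈ Den(A); from it,
-- x → y ∈ Den(A) holds exactly when x ≤ y⁻∼.  The opposite pseudo-hoop (⊙ reversed,
-- → and ⇝ exchanged) is again good, has the same order and the same Den, and the
-- characterisation there reads x ⇝ y ∈ Den(A) iff x ≤ y∼⁻ = y⁻∼: this gives normality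
-- and the second involutivity condition.

module Submission where

open import Defs
open import Level using (Level)
open import Data.Product using (_×_; _,_; proj₁; proj₂; swap)
open import Relation.Binary.PropositionalEquality
  using (_≡_; sym; trans; cong; subst; module ≡-Reasoning)
open import Function.Bundles using (_⇔_; mk⇔; Equivalence)
open import Function.Properties.Equivalence using () renaming (sym to ⇔-sym; trans to ⇔-trans)

open Equivalence using (to; from)

private
  variable
    a : Level

module PseudoHoopProperties (H : PseudoHoop a) where
  open PseudoHoop H
  open ≡-Reasoning

  ≤-antisym : ∀ {x y} → x ≤ y → y ≤ x → x ≡ y
  ≤-antisym {x} {y} x≤y y≤x = begin
    x             ≡⟨ sym (⊙-identityˡ x) ⟩
    𝟙 ⊙ x         ≡⟨ cong (_⊙ x) (sym x≤y) ⟩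
    (x ⇒ y) ⊙ x   ≡⟨ div₁ x y ⟩
    (y ⇒ x) ⊙ y   ≡⟨ cong (_⊙ y) y≤x ⟩
    𝟙 ⊙ y         ≡⟨ ⊙-identityˡ y ⟩
    y             ∎

  residual-⇒ : ∀ {x y z} → (x ⊙ y) ≤ z ⇔ x ≤ (y ⇒ z)
  residual-⇒ {x} {y} {z} = mk⇔ (trans (sym (⊙-⇒ x y z))) (trans (⊙-⇒ x y z))

  ⇒-mp : ∀ x y → ((x ⇒ y) ⊙ x) ≤ y
  ⇒-mp x y = from residual-⇒ (⇒-refl (x ⇒ y))

  ⇒-identityˡ : ∀ x → 𝟙 ⇒ x ≡ x
  ⇒-identityˡ x = ≤-antisym 𝟙⇒x≤x x≤𝟙⇒x
    where
    𝟙⇒x≤x : (𝟙 ⇒ x) ≤ x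
    𝟙⇒x≤x = subst (_≤ x) (⊙-identityʳ (𝟙 ⇒ x)) (⇒-mp 𝟙 x)
    x≤𝟙⇒x : x ≤ (𝟙 ⇒ x)
    x≤𝟙⇒x = to residual-⇒ (subst (_≤ x) (sym (⊙-identityʳ x)) (⇒-refl x))

  ⇒-zeroʳ : ∀ x → x ⇒ 𝟙 ≡ 𝟙
  ⇒-zeroʳ x = begin
    x ⇒ 𝟙                   ≡⟨ cong (_⇒ 𝟙) (sym [x⇒𝟙]⊙x≡x) ⟩
    ((x ⇒ 𝟙) ⊙ x) ⇒ 𝟙       ≡⟨ ⊙-⇒ (x ⇒ 𝟙) x 𝟙 ⟩
    (x ⇒ 𝟙) ⇒ (x ⇒ 𝟙)       ≡⟨ ⇒-refl (x ⇒ 𝟙) ⟩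
    𝟙                       ∎
    where
    [x⇒𝟙]⊙x≡x : (x ⇒ 𝟙) ⊙ x ≡ x
    [x⇒𝟙]⊙x≡x = trans (div₁ x 𝟙) (trans (⊙-identityʳ (𝟙 ⇒ x)) (⇒-identityˡ x))

  ⇝-zeroʳ : ∀ x → x ⇝ 𝟙 ≡ 𝟙
  ⇝-zeroʳ x = begin
    x ⇝ 𝟙                   ≡⟨ cong (_⇝ 𝟙) (sym x⊙[x⇝𝟙]≡x) ⟩
    (x ⊙ (x ⇝ 𝟙)) ⇝ 𝟙       ≡⟨ ⊙-⇝ x (x ⇝ 𝟙) 𝟙 ⟩
    (x ⇝ 𝟙) ⇝ (x ⇝ 𝟙)       ≡⟨ ⇝-refl (x ⇝ 𝟙) ⟩
    𝟙                       ∎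
    where
    x⊙[x⇝𝟙]≡x : x ⊙ (x ⇝ 𝟙) ≡ x
    x⊙[x⇝𝟙]≡x = trans (sym (div₂ x 𝟙)) (trans (⊙-identityʳ (𝟙 ⇒ x)) (⇒-identityˡ x))

  x⊙y≤y : ∀ x y → (x ⊙ y) ≤ y
  x⊙y≤y x y = trans (⊙-⇒ x y y) (trans (cong (x ⇒_) (⇒-refl y)) (⇒-zeroʳ x))

  divisibleˡ : ∀ {x y} → x ≤ y → (y ⇒ x) ⊙ y ≡ x
  divisibleˡ {x} {y} x≤y = begin
    (y ⇒ x) ⊙ y   ≡⟨ sym (div₁ x y) ⟩
    (x ⇒ y) ⊙ x   ≡⟨ cong (_⊙ x) x≤y ⟩
    𝟙 ⊙ x         ≡⟨ ⊙-identityˡ x ⟩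
    x             ∎

  divisibleʳ : ∀ {x y} → x ≤ y → y ⊙ (y ⇝ x) ≡ x
  divisibleʳ {x} {y} x≤y = begin
    y ⊙ (y ⇝ x)   ≡⟨ sym (div₃ x y) ⟩
    x ⊙ (x ⇝ y)   ≡⟨ sym (div₂ x y) ⟩
    (y ⇒ x) ⊙ y   ≡⟨ divisibleˡ x≤y ⟩
    x             ∎

  ≤⇔⇝≡𝟙 : ∀ {x y} → x ≤ y ⇔ x ⇝ y ≡ 𝟙
  ≤⇔⇝≡𝟙 {x} {y} = mk⇔ x⇝y≡𝟙 x≤y
    where
    x⇝y≡𝟙 : x ≤ y → x ⇝ y ≡ 𝟙
    x⇝y≡𝟙 p = begin
      x ⇝ y                 ≡⟨ cong (_⇝ y) (sym (divisibleʳ p)) ⟩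
      (y ⊙ (y ⇝ x)) ⇝ y     ≡⟨ ⊙-⇝ y (y ⇝ x) y ⟩
      (y ⇝ x) ⇝ (y ⇝ y)     ≡⟨ cong ((y ⇝ x) ⇝_) (⇝-refl y) ⟩
      (y ⇝ x) ⇝ 𝟙           ≡⟨ ⇝-zeroʳ (y ⇝ x) ⟩
      𝟙                     ∎
    x≤y : x ⇝ y ≡ 𝟙 → x ≤ y
    x≤y p = subst (_≤ y) [y⇒x]⊙y≡x (x⊙y≤y (y ⇒ x) y)
      where
      [y⇒x]⊙y≡x : (y ⇒ x) ⊙ y ≡ x
      [y⇒x]⊙y≡x = trans (div₂ x y) (trans (cong (x ⊙_) p) (⊙-identityʳ x))

  ≤-trans : ∀ {x y z} → x ≤ y → y ≤ z → x ≤ z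
  ≤-trans {x} {y} {z} x≤y y≤z = begin
    x ⇒ z                   ≡⟨ cong (_⇒ z) (sym (divisibleˡ x≤y)) ⟩
    ((y ⇒ x) ⊙ y) ⇒ z       ≡⟨ ⊙-⇒ (y ⇒ x) y z ⟩
    (y ⇒ x) ⇒ (y ⇒ z)       ≡⟨ cong ((y ⇒ x) ⇒_) y≤z ⟩
    (y ⇒ x) ⇒ 𝟙             ≡⟨ ⇒-zeroʳ (y ⇒ x) ⟩
    𝟙                       ∎

  residual-⇝ : ∀ {x y z} → (x ⊙ y) ≤ z ⇔ y ≤ (x ⇝ z)
  residual-⇝ {x} {y} {z} = mk⇔
    (λ p → from ≤⇔⇝≡𝟙 (trans (sym (⊙-⇝ x y z)) (to ≤⇔⇝≡𝟙 p)))
    (λ p → from ≤⇔⇝≡𝟙 (trans (⊙-⇝ x y z) (to ≤⇔⇝≡𝟙 p)))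

  ⇝-mp : ∀ x y → (x ⊙ (x ⇝ y)) ≤ y
  ⇝-mp x y = from residual-⇝ (⇒-refl (x ⇝ y))

  ⊙-monoʳ-≤ : ∀ {x y} z → x ≤ y → (z ⊙ x) ≤ (z ⊙ y)
  ⊙-monoʳ-≤ {y = y} z x≤y = from residual-⇝ (≤-trans x≤y (to residual-⇝ (⇒-refl (z ⊙ y))))

  ⊙-monoˡ-≤ : ∀ {x y} z → x ≤ y → (x ⊙ z) ≤ (y ⊙ z)
  ⊙-monoˡ-≤ {y = y} z x≤y = from residual-⇒ (≤-trans x≤y (to residual-⇒ (⇒-refl (y ⊙ z))))

  ⇒-antimonoˡ-≤ : ∀ {x y} z → x ≤ y → (y ⇒ z) ≤ (x ⇒ z)
  ⇒-antimonoˡ-≤ {y = y} z x≤y = to residual-⇒ (≤-trans (⊙-monoʳ-≤ (y ⇒ z) x≤y) (⇒-mp y z))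

  ⊙-assoc : ∀ x y z → (x ⊙ y) ⊙ z ≡ x ⊙ (y ⊙ z)
  ⊙-assoc x y z = ≤-antisym (trans (⇒-curry _) (⇒-refl _)) (trans (sym (⇒-curry _)) (⇒-refl _))
    where
    ⇒-curry : ∀ w → ((x ⊙ y) ⊙ z) ⇒ w ≡ (x ⊙ (y ⊙ z)) ⇒ w
    ⇒-curry w = begin
      ((x ⊙ y) ⊙ z) ⇒ w     ≡⟨ ⊙-⇒ (x ⊙ y) z w ⟩
      (x ⊙ y) ⇒ (z ⇒ w)     ≡⟨ ⊙-⇒ x y (z ⇒ w) ⟩
      x ⇒ (y ⇒ (z ⇒ w))     ≡⟨ cong (x ⇒_) (sym (⊙-⇒ y z w)) ⟩
      x ⇒ ((y ⊙ z) ⇒ w)     ≡⟨ sym (⊙-⇒ x (y ⊙ z) w) ⟩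
      (x ⊙ (y ⊙ z)) ⇒ w     ∎

opposite : PseudoHoop a → PseudoHoop a
opposite H = record
  { Carrier = Carrier
  ; _⊙_ = λ x y → y ⊙ x
  ; _⇒_ = _⇝_
  ; _⇝_ = _⇒_
  ; 𝟙 = 𝟙
  ; ⊙-identityʳ = ⊙-identityˡ
  ; ⊙-identityˡ = ⊙-identityʳ
  ; ⇒-refl = ⇝-refl
  ; ⇝-refl = ⇒-refl
  ; ⊙-⇒ = λ x y z → ⊙-⇝ y x z
  ; ⊙-⇝ = λ x y z → ⊙-⇒ y x z
  ; div₁ = div₃
  ; div₂ = λ x y → sym (div₂ y x)
  ; div₃ = div₁
  }
  where open PseudoHoop H

bounded-opposite : BoundedPseudoHoop a → BoundedPseudoHoop a
bounded-opposite A = record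
  { pseudoHoop = opposite pseudoHoop
  ; 𝟘 = 𝟘
  ; 𝟘-least = λ x → to ≤⇔⇝≡𝟙 (𝟘-least x)
  }
  where
  open BoundedPseudoHoop A
  open PseudoHoopProperties pseudoHoop

module BoundedPseudoHoopProperties (A : BoundedPseudoHoop a) where
  open BoundedPseudoHoop A
  open PseudoHoopProperties pseudoHoop public

  x≤𝟘⇒x≡𝟘 : ∀ {x} → x ≤ 𝟘 → x ≡ 𝟘
  x≤𝟘⇒x≡𝟘 {x} x≤𝟘 = ≤-antisym x≤𝟘 (𝟘-least x)

  x≤x⁻∼ : ∀ x → x ≤ (x ⁻∼)
  x≤x⁻∼ x = to residual-⇝ (⇒-mp x 𝟘)

  ⁻∼≡𝟙⇔⁻≡𝟘 : ∀ {x} → x ⁻∼ ≡ 𝟙 ⇔ x ⁻ ≡ 𝟘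
  ⁻∼≡𝟙⇔⁻≡𝟘 {x} = mk⇔ (λ p → x≤𝟘⇒x≡𝟘 (from ≤⇔⇝≡𝟙 p))
                      (λ p → trans (cong _∼ p) (⇝-refl 𝟘))

  ∼⁻≡𝟙⇔∼≡𝟘 : ∀ {x} → x ∼⁻ ≡ 𝟙 ⇔ x ∼ ≡ 𝟘
  ∼⁻≡𝟙⇔∼≡𝟘 {x} = mk⇔ x≤𝟘⇒x≡𝟘 (λ p → trans (cong _⁻ p) (⇒-refl 𝟘))

module GoodPseudoHoopProperties (A : BoundedPseudoHoop a) (good : IsGood A) where
  open BoundedPseudoHoop A
  open BoundedPseudoHoopProperties A

  Den⇔⁻≡𝟘 : ∀ {x} → Den A x ⇔ x ⁻ ≡ 𝟘
  Den⇔⁻≡𝟘 {x} = mk⇔ (λ d → to ⁻∼≡𝟙⇔⁻≡𝟘 (proj₁ d))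
                    (λ p → let x⁻∼≡𝟙 = from ⁻∼≡𝟙⇔⁻≡𝟘 p in x⁻∼≡𝟙 , trans (sym (good x)) x⁻∼≡𝟙)

  Den⇔∼≡𝟘 : ∀ {x} → Den A x ⇔ x ∼ ≡ 𝟘
  Den⇔∼≡𝟘 {x} = mk⇔ (λ d → to ∼⁻≡𝟙⇔∼≡𝟘 (proj₂ d))
                    (λ p → let x∼⁻≡𝟙 = from ∼⁻≡𝟙⇔∼≡𝟘 p in trans (good x) x∼⁻≡𝟙 , x∼⁻≡𝟙)

  Den-upward : ∀ {x y} → Den A x → x ≤ y → Den A y
  Den-upward {x} {y} dx x≤y = from Den⇔⁻≡𝟘 (x≤𝟘⇒x≡𝟘 y⁻≤𝟘)
    where
    y⁻≤𝟘 : (y ⁻) ≤ 𝟘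
    y⁻≤𝟘 = subst ((y ⁻) ≤_) (to Den⇔⁻≡𝟘 dx) (⇒-antimonoˡ-≤ 𝟘 x≤y)

  Den-isFilter : IsFilter A (Den A)
  Den-isFilter = record
    { nonempty = 𝟙 , from Den⇔⁻≡𝟘 (⇒-identityˡ 𝟘)
    ; ⊙-closed = λ {x} {y} dx dy → from Den⇔⁻≡𝟘
        (trans (⊙-⇒ x y 𝟘) (trans (cong (x ⇒_) (to Den⇔⁻≡𝟘 dy)) (to Den⇔⁻≡𝟘 dx)))
    ; upward = Den-upward
    }

  -- With n = x⁻∼, u = n → x and z = u∼: z lies below n, so z = n ⊙ c with c = n ⇝ z;
  -- as u ⊙ n = x this gives x ⊙ c ≤ 0, i.e. c ≤ x∼, and then z ≤ n ⊙ x∼ = x∼⁻ ⊙ x∼ ≤ 0.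
  Den-⁻∼⇒ : ∀ x → Den A (x ⁻∼ ⇒ x)
  Den-⁻∼⇒ x = from Den⇔∼≡𝟘 (x≤𝟘⇒x≡𝟘 (≤-trans z≤n⊙x∼ n⊙x∼≤𝟘))
    where
    n = x ⁻∼
    u = n ⇒ x
    z = u ∼
    c = n ⇝ z
    u⊙z≤𝟘 : (u ⊙ z) ≤ 𝟘
    u⊙z≤𝟘 = ⇝-mp u 𝟘
    x⁻≤u : (x ⁻) ≤ u
    x⁻≤u = to residual-⇒ (≤-trans (⇝-mp (x ⁻) 𝟘) (𝟘-least x))
    z≤n : z ≤ n
    z≤n = to residual-⇝ (≤-trans (⊙-monoˡ-≤ z x⁻≤u) u⊙z≤𝟘)
    u⊙z≡x⊙c : u ⊙ z ≡ x ⊙ c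
    u⊙z≡x⊙c = begin
      u ⊙ z         ≡⟨ cong (u ⊙_) (sym (divisibleʳ z≤n)) ⟩
      u ⊙ (n ⊙ c)   ≡⟨ sym (⊙-assoc u n c) ⟩
      (u ⊙ n) ⊙ c   ≡⟨ cong (_⊙ c) (divisibleˡ (x≤x⁻∼ x)) ⟩
      x ⊙ c         ∎
      where open ≡-Reasoning
    c≤x∼ : c ≤ (x ∼)
    c≤x∼ = to residual-⇝ (subst (_≤ 𝟘) u⊙z≡x⊙c u⊙z≤𝟘)
    z≤n⊙x∼ : z ≤ (n ⊙ (x ∼))
    z≤n⊙x∼ = subst (_≤ (n ⊙ (x ∼))) (divisibleʳ z≤n) (⊙-monoʳ-≤ n c≤x∼)
    n⊙x∼≤𝟘 : (n ⊙ (x ∼)) ≤ 𝟘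
    n⊙x∼≤𝟘 = subst (λ m → (m ⊙ (x ∼)) ≤ 𝟘) (sym (good x)) (⇒-mp (x ∼) 𝟘)

  Den-⇒⇔≤⁻∼ : ∀ {x y} → Den A (x ⇒ y) ⇔ x ≤ (y ⁻∼)
  Den-⇒⇔≤⁻∼ {x} {y} = mk⇔ x≤y⁻∼ (λ p → Den-upward (Den-⁻∼⇒ y) (⇒-antimonoˡ-≤ y p))
    where
    x≤y⁻∼ : Den A (x ⇒ y) → x ≤ (y ⁻∼)
    x≤y⁻∼ d = subst (x ≤_) (sym (good y)) (to residual-⇒ x⊙y∼≤𝟘)
      where
      [x⇒y]⊙x⊙y∼≤𝟘 : ((x ⇒ y) ⊙ (x ⊙ (y ∼))) ≤ 𝟘
      [x⇒y]⊙x⊙y∼≤𝟘 = subst (_≤ 𝟘) (⊙-assoc (x ⇒ y) x (y ∼))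
                        (≤-trans (⊙-monoˡ-≤ (y ∼) (⇒-mp x y)) (⇝-mp y 𝟘))
      x⊙y∼≤𝟘 : (x ⊙ (y ∼)) ≤ 𝟘
      x⊙y∼≤𝟘 = subst ((x ⊙ (y ∼)) ≤_) (to Den⇔∼≡𝟘 d) (to residual-⇝ [x⇒y]⊙x⊙y∼≤𝟘)

module _ (A : BoundedPseudoHoop a) (good : IsGood A) where
  open BoundedPseudoHoop A
  open BoundedPseudoHoopProperties A using (≤⇔⇝≡𝟙)
  open GoodPseudoHoopProperties A good
  private
    module Op = GoodPseudoHoopProperties (bounded-opposite A) (λ x → sym (good x))

  Den⇔Den-opposite : ∀ {x} → Den A x ⇔ Den (bounded-opposite A) x
  Den⇔Den-opposite = mk⇔ swap swap

  Den-⇒⇔Den-⇝ : ∀ x y → Den A (x ⇒ y) ⇔ Den A (x ⇝ y)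
  Den-⇒⇔Den-⇝ x y =
    ⇔-trans Den-⇒⇔≤⁻∼
    (⇔-trans (mk⇔ (subst (x ≤_) (good y)) (subst (x ≤_) (sym (good y))))
    (⇔-trans ≤⇔⇝≡𝟙
    (⇔-trans (⇔-sym Op.Den-⇒⇔≤⁻∼)
             (⇔-sym Den⇔Den-opposite))))

  Den-∼⁻⇝ : ∀ x → Den A (x ∼⁻ ⇝ x)
  Den-∼⁻⇝ x = from Den⇔Den-opposite (Op.Den-⁻∼⇒ x)

proposition4p4 : {a : Level} (A : BoundedPseudoHoop a) → IsGood A → IsNormalFilter A (Den A) × IsInvolutiveFilter A (Den A)
proposition4p4 A good =
  record { isFilter = Den-isFilter ; normal = Den-⇒⇔Den-⇝ A good } ,
  record { isFilter = Den-isFilter ; inv₁ = Den-⁻∼⇒ ; inv₂ = Den-∼⁻⇝ A good }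
  where open GoodPseudoHoopProperties A good
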